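{- For every $n\ge 2$, $$D_t(F_{n,4},x)=x(x+2)\Big[(x+1)D_t(F_{n-1,4},x)-(x^3+2x^2)^{n-1}\Big],$$ with initial value $D_t(F_{1,4},x)=x^4+4x^3+4x^2$.
   Context: All graphs are finite and simple. $F_{n,4}$ is the graph consisting of $n$ cycles of length $4$ all sharing exactly one common vertex and otherwise pairwise vertex-disjoint. A set $D$ of vertices of a graph $G$ is a total dominating set if every vertex of $G$ is adjacent to some vertex of $D$. Let $d_t(G,i)$ be the number of total dominating sets of $G$ of size $i$; the total domination polynomial is $D_t(G,x)=\sum_{i\ge 1} d_t(G,i)x^i$. (Note $x^3+2x^2=D_t(P_3,x)$.) -}

module Defs where

open import Data.Nat using (ℕ; zero; suc; _+_; _*_; _∸_; _≡ᵇ_; _<ᵇ_)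
open import Data.Nat.DivMod using (_%_)
open import Data.Bool using (Bool; true; false; _∧_; _∨_; not; if_then_else_)
open import Data.Fin using (Fin; toℕ)
open import Data.Vec using (Vec; []; _∷_; lookup)
open import Data.List using (List; []; _∷_; map; _++_; length; filterᵇ; allFin)
open import Data.Bool.ListAction using (any; all)
open import Data.Integer using (ℤ; +_) renaming (_+_ to _+ℤ_; _*_ to _*ℤ_; _-_ to _-ℤ_)

-- Finite simple graphs: vertex set Fin V, symmetric irreflexive Bool adjacency.
-- (F n below is symmetric and loopless by construction.)

record Graph : Set where
  field
    V   : ℕ
    adj : Fin V → Fin V → Bool
open Graph public

-- F_{n,4}: vertex 0 is the common vertex; cycle j (0 ≤ j < n) is
--   0 — 3j+1 — 3j+2 — 3j+3 — 0 .
-- Vertex set {0,…,3n}.  edgeℕ u v decides the edge {u,v} for u < v.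

edgeℕ : ℕ → ℕ → Bool
edgeℕ u v =
  ((u ≡ᵇ 0) ∧ ((v % 3 ≡ᵇ 1) ∨ (v % 3 ≡ᵇ 0)))
  ∨ (not (u ≡ᵇ 0) ∧ (v ≡ᵇ suc u) ∧ not (u % 3 ≡ᵇ 0))

adjℕ : ℕ → ℕ → Bool
adjℕ u v = ((u <ᵇ v) ∧ edgeℕ u v) ∨ ((v <ᵇ u) ∧ edgeℕ v u)

F4 : ℕ → Graph
F4 n = record { V = suc (3 * n) ; adj = λ u v → adjℕ (toℕ u) (toℕ v) }

Subset : ℕ → Set
Subset n = Vec Bool n

allSubsets : (n : ℕ) → List (Subset n)
allSubsets zero    = [] ∷ []
allSubsets (suc n) = map (false ∷_) (allSubsets n) ++ map (true ∷_) (allSubsets n)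

size : ∀ {n} → Subset n → ℕ
size []          = 0
size (false ∷ s) = size s
size (true  ∷ s) = suc (size s)

isTDS : (G : Graph) → Subset (V G) → Bool
isTDS G D = all (λ v → any (λ u → adj G v u ∧ lookup D u) (allFin (V G))) (allFin (V G))

dt : Graph → ℕ → ℕ
dt G i = length (filterᵇ (λ D → isTDS G D ∧ (size D ≡ᵇ i)) (allSubsets (V G)))

-- Polynomials over ℤ as coefficient sequences (coefficient of x^k).

Poly : Set
Poly = ℕ → ℤ

_⊕_ : Poly → Poly → Poly
(p ⊕ q) k = p k +ℤ q k

_⊖_ : Poly → Poly → Poly
(p ⊖ q) k = p k -ℤ q k

-- Σ_{i=0}^{k} f i (k - i)
conv : (ℕ → ℕ → ℤ) → ℕ → ℤ
conv f zero    = f 0 0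
conv f (suc k) = f (suc k) 0 +ℤ conv (λ i j → f i (suc j)) k

_⊛_ : Poly → Poly → Poly
(p ⊛ q) k = conv (λ i j → p i *ℤ q j) k

const : ℤ → Poly
const c zero    = c
const c (suc k) = + 0

X : Poly
X 1 = + 1
X _ = + 0

_^ᴾ_ : Poly → ℕ → Poly
p ^ᴾ zero  = const (+ 1)
p ^ᴾ suc n = p ⊛ (p ^ᴾ n)

-- Total domination polynomial D_t(G,x) = Σ_{i≥1} d_t(G,i) x^i.
Dt : Graph → Poly
Dt G zero    = + 0
Dt G (suc i) = + dt G (suc i)

-- x^3 + 2x^2  (= D_t(P_3,x))
P3poly : Poly
P3poly = (X ^ᴾ 3) ⊕ (const (+ 2) ⊛ (X ^ᴾ 2))

F1poly : Poly
F1poly = (X ^ᴾ 4) ⊕ ((const (+ 4) ⊛ (X ^ᴾ 3)) ⊕ (const (+ 4) ⊛ (X ^ᴾ 2)))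

-- Write each cycle as hub – a – b – d – hub.  Vertices a and d are
-- dominated iff the hub or b lies in D, vertex b iff a or d does, and for
-- n ≥ 1 the hub is then dominated automatically.  Hence, given the hub bit,
-- the n cycles are independent, and D_t(F_{n,4}) = x · (x(x+1)(x+2))ⁿ +
-- (x³ + 2x²)ⁿ.  The recurrence and the initial value are ring identities
-- between these closed forms.

module Submission where

open import Defs
open import Data.Bool using (Bool; true; false; _∧_; _∨_; not; if_then_else_)
open import Data.Bool.Properties using (∧-zeroʳ; ∨-identityʳ)
open import Data.Bool.ListAction using (and; or)
open import Data.Nat using (ℕ; zero; suc; _≤_; _∸_; s≤s; _≡ᵇ_; _<ᵇ_; _%_)
import Data.Nat as ℕ using (_+_; _*_)
import Data.Nat.Properties as ℕ using (+-comm; *-comm)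
open import Data.Nat.DivMod using ([m+n]%n≡m%n)
open import Data.Fin using (Fin; toℕ)
open import Data.Integer using (ℤ; +_; -_; _+_; _*_)
import Data.Integer as ℤ using (+-*-rawRing; _≟_)
import Data.Integer.Properties as ℤ
open import Algebra.Properties.CommutativeSemigroup ℤ.+-commutativeSemigroup
  using () renaming (interchange to +-interchange)
open import Data.List
  using (List; []; _∷_; _++_; length; map; take; drop; filterᵇ; tabulate; allFin)
open import Data.List.Properties using (length-++; filter-++; map-tabulate; tabulate-cong)
open import Data.Vec using ([]; _∷_; toList; lookup; cast)
open import Data.Vec.Properties using (toList-cast)
open import Data.Maybe using (Maybe; just; nothing)
open import Data.Product using (_×_; _,_)
open import Function using (_∘_; id)
open import Level using (0ℓ)
open import Relation.Nullary using (yes; no)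
open import Relation.Nullary.Decidable using (T?)
open import Relation.Binary using (IsEquivalence)
open import Relation.Binary.PropositionalEquality
import Relation.Binary.Reasoning.Setoid as SetoidReasoning
open import Algebra.Bundles using (CommutativeRing)
open import Algebra.Solver.Ring.AlmostCommutativeRing
  using (_-Raw-AlmostCommutative⟶_; fromCommutativeRing)

infix 4 _≈ᴾ_
_≈ᴾ_ : Poly → Poly → Set
p ≈ᴾ q = ∀ k → p k ≡ q k

-- Zero and one are
-- constant polynomials, so they agree definitionally with the ring solver's
-- interpretation of the integer constants 0 and 1.
0ᴾ : Poly
0ᴾ = const (+ 0)

0ᴾ-coeff : ∀ k → 0ᴾ k ≡ + 0
0ᴾ-coeff zero    = refl
0ᴾ-coeff (suc k) = refl

1ᴾ : Poly
1ᴾ = const (+ 1)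

-ᴾ_ : Poly → Poly
(-ᴾ p) k = - p k

shiftᴾ : Poly → Poly
shiftᴾ p k = p (suc k)

scale : ℤ → Poly → Poly
scale c p k = c * p k

conv-cong : ∀ {f g : ℕ → ℕ → ℤ} → (∀ i j → f i j ≡ g i j) → ∀ k → conv f k ≡ conv g k
conv-cong e zero    = e 0 0
conv-cong e (suc k) = cong₂ _+_ (e (suc k) 0) (conv-cong (λ i j → e i (suc j)) k)

conv-+ : ∀ (f g : ℕ → ℕ → ℤ) k → conv (λ i j → f i j + g i j) k ≡ conv f k + conv g k
conv-+ f g zero    = refl
conv-+ f g (suc k) = begin
  (f (suc k) 0 + g (suc k) 0) + conv (λ i j → f i (suc j) + g i (suc j)) k
    ≡⟨ cong (_+_ (f (suc k) 0 + g (suc k) 0))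
            (conv-+ (λ i j → f i (suc j)) (λ i j → g i (suc j)) k) ⟩
  (f (suc k) 0 + g (suc k) 0) + (conv (λ i j → f i (suc j)) k + conv (λ i j → g i (suc j)) k)
    ≡⟨ +-interchange (f (suc k) 0) (g (suc k) 0) _ _ ⟩
  (f (suc k) 0 + conv (λ i j → f i (suc j)) k) + (g (suc k) 0 + conv (λ i j → g i (suc j)) k) ∎
  where open ≡-Reasoning

conv-scale : ∀ c (f : ℕ → ℕ → ℤ) k → conv (λ i j → c * f i j) k ≡ c * conv f k
conv-scale c f zero    = refl
conv-scale c f (suc k) =
  trans (cong (_+_ (c * f (suc k) 0)) (conv-scale c (λ i j → f i (suc j)) k))
        (sym (ℤ.*-distribˡ-+ c (f (suc k) 0) _))

conv-peel : ∀ (f : ℕ → ℕ → ℤ) k → conv f (suc k) ≡ conv (λ i j → f (suc i) j) k + f 0 (suc k)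
conv-peel f zero    = refl
conv-peel f (suc k) =
  trans (cong (_+_ (f (suc (suc k)) 0)) (conv-peel (λ i j → f i (suc j)) k))
        (sym (ℤ.+-assoc (f (suc (suc k)) 0) _ _))

conv-swap : ∀ (f : ℕ → ℕ → ℤ) k → conv f k ≡ conv (λ i j → f j i) k
conv-swap f zero    = refl
conv-swap f (suc k) =
  trans (conv-peel f k)
  (trans (cong (_+ f 0 (suc k)) (conv-swap (λ i j → f (suc i) j) k))
         (ℤ.+-comm _ (f 0 (suc k))))

⊕-cong : ∀ {p p′ q q′} → p ≈ᴾ p′ → q ≈ᴾ q′ → p ⊕ q ≈ᴾ p′ ⊕ q′
⊕-cong e e′ k = cong₂ _+_ (e k) (e′ k)

⊛-cong : ∀ {p p′ q q′} → p ≈ᴾ p′ → q ≈ᴾ q′ → p ⊛ q ≈ᴾ p′ ⊛ q′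
⊛-cong e e′ = conv-cong (λ i j → cong₂ _*_ (e i) (e′ j))

⊛-congˡ : ∀ r {p q} → p ≈ᴾ q → r ⊛ p ≈ᴾ r ⊛ q
⊛-congˡ r = ⊛-cong {p = r} (λ _ → refl)

⊛-comm : ∀ p q → p ⊛ q ≈ᴾ q ⊛ p
⊛-comm p q k = trans (conv-swap _ k) (conv-cong (λ i j → ℤ.*-comm (p j) (q i)) k)

⊛-distribʳ : ∀ r p q → (p ⊕ q) ⊛ r ≈ᴾ (p ⊛ r) ⊕ (q ⊛ r)
⊛-distribʳ r p q k =
  trans (conv-cong (λ i j → ℤ.*-distribʳ-+ (r j) (p i) (q i)) k) (conv-+ _ _ k)

⊛-distribˡ : ∀ r p q → r ⊛ (p ⊕ q) ≈ᴾ (r ⊛ p) ⊕ (r ⊛ q)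
⊛-distribˡ r p q k =
  trans (conv-cong (λ i j → ℤ.*-distribˡ-+ (r i) (p j) (q j)) k) (conv-+ _ _ k)

scale-⊛ : ∀ c p q → scale c p ⊛ q ≈ᴾ scale c (p ⊛ q)
scale-⊛ c p q k = trans (conv-cong (λ i j → ℤ.*-assoc c (p i) (q j)) k) (conv-scale c _ k)

const-⊛ : ∀ c p → const c ⊛ p ≈ᴾ scale c p
const-⊛ c p zero    = refl
const-⊛ c p (suc k) =
  trans (ℤ.+-identityˡ _) (const-⊛ c (shiftᴾ p) k)

⊛-suc : ∀ p q k → (p ⊛ q) (suc k) ≡ (shiftᴾ p ⊛ q) k + p 0 * q (suc k)
⊛-suc p q = conv-peel (λ i j → p i * q j)

⊛-assoc : ∀ p q r → (p ⊛ q) ⊛ r ≈ᴾ p ⊛ (q ⊛ r)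
⊛-assoc p q r zero    = ℤ.*-assoc (p 0) (q 0) (r 0)
⊛-assoc p q r (suc k) = begin
  ((p ⊛ q) ⊛ r) (suc k)
    ≡⟨ ⊛-suc (p ⊛ q) r k ⟩
  (shiftᴾ (p ⊛ q) ⊛ r) k + (p 0 * q 0) * r (suc k)
    ≡⟨ cong (_+ (p 0 * q 0) * r (suc k)) shifted ⟩
  ((shiftᴾ p ⊛ (q ⊛ r)) k + p 0 * (shiftᴾ q ⊛ r) k) + (p 0 * q 0) * r (suc k)
    ≡⟨ regroup ((shiftᴾ p ⊛ (q ⊛ r)) k) (p 0) ((shiftᴾ q ⊛ r) k) (q 0) (r (suc k)) ⟩
  (shiftᴾ p ⊛ (q ⊛ r)) k + p 0 * ((shiftᴾ q ⊛ r) k + q 0 * r (suc k))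
    ≡⟨ cong (λ z → (shiftᴾ p ⊛ (q ⊛ r)) k + p 0 * z) (sym (⊛-suc q r k)) ⟩
  (shiftᴾ p ⊛ (q ⊛ r)) k + p 0 * (q ⊛ r) (suc k)
    ≡⟨ sym (⊛-suc p (q ⊛ r) k) ⟩
  (p ⊛ (q ⊛ r)) (suc k) ∎
  where
  open ≡-Reasoning
  shifted : (shiftᴾ (p ⊛ q) ⊛ r) k ≡ (shiftᴾ p ⊛ (q ⊛ r)) k + p 0 * (shiftᴾ q ⊛ r) k
  shifted = begin
    (shiftᴾ (p ⊛ q) ⊛ r) k
      ≡⟨ ⊛-cong (⊛-suc p q) (λ _ → refl) k ⟩
    (((shiftᴾ p ⊛ q) ⊕ scale (p 0) (shiftᴾ q)) ⊛ r) k
      ≡⟨ ⊛-distribʳ r (shiftᴾ p ⊛ q) (scale (p 0) (shiftᴾ q)) k ⟩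
    ((shiftᴾ p ⊛ q) ⊛ r) k + (scale (p 0) (shiftᴾ q) ⊛ r) k
      ≡⟨ cong₂ _+_ (⊛-assoc (shiftᴾ p) q r k) (scale-⊛ (p 0) (shiftᴾ q) r k) ⟩
    (shiftᴾ p ⊛ (q ⊛ r)) k + p 0 * (shiftᴾ q ⊛ r) k ∎
  regroup : ∀ a b c d e → (a + b * c) + (b * d) * e ≡ a + b * (c + d * e)
  regroup a b c d e = begin
    (a + b * c) + (b * d) * e  ≡⟨ ℤ.+-assoc a (b * c) _ ⟩
    a + (b * c + (b * d) * e)  ≡⟨ cong (λ z → a + (b * c + z)) (ℤ.*-assoc b d e) ⟩
    a + (b * c + b * (d * e))  ≡⟨ cong (_+_ a) (sym (ℤ.*-distribˡ-+ b c (d * e))) ⟩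
    a + b * (c + d * e)        ∎

PolyRing : CommutativeRing 0ℓ 0ℓ
PolyRing = record
  { Carrier = Poly
  ; _≈_ = _≈ᴾ_
  ; _+_ = _⊕_
  ; _*_ = _⊛_
  ; -_  = -ᴾ_
  ; 0#  = 0ᴾ
  ; 1#  = 1ᴾ
  ; isCommutativeRing = record
    { isRing = record
      { +-isAbelianGroup = record
        { isGroup = record
          { isMonoid = record
            { isSemigroup = record
              { isMagma = record { isEquivalence = ≈ᴾ-isEquivalence ; ∙-cong = ⊕-cong }
              ; assoc = λ p q r k → ℤ.+-assoc (p k) (q k) (r k) }
            ; identity = (λ p k → trans (cong (_+ p k) (0ᴾ-coeff k)) (ℤ.+-identityˡ (p k)))
                       , (λ p k → trans (cong (_+_ (p k)) (0ᴾ-coeff k))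
                                         (ℤ.+-identityʳ (p k))) }
          ; inverse = (λ p k → trans (ℤ.+-inverseˡ (p k)) (sym (0ᴾ-coeff k)))
                    , (λ p k → trans (ℤ.+-inverseʳ (p k)) (sym (0ᴾ-coeff k)))
          ; ⁻¹-cong = λ e k → cong -_ (e k) }
        ; comm = λ p q k → ℤ.+-comm (p k) (q k) }
      ; *-cong = ⊛-cong
      ; *-assoc = ⊛-assoc
      ; *-identity = ⊛-identityˡ , (λ p k → trans (⊛-comm p 1ᴾ k) (⊛-identityˡ p k))
      ; distrib = ⊛-distribˡ , ⊛-distribʳ }
    ; *-comm = ⊛-comm }
  }
  where
  ≈ᴾ-isEquivalence : IsEquivalence _≈ᴾ_
  ≈ᴾ-isEquivalence = record
    { refl  = λ _ → refl
    ; sym   = λ e k → sym (e k)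
    ; trans = λ e e′ k → trans (e k) (e′ k) }
  ⊛-identityˡ : ∀ p → 1ᴾ ⊛ p ≈ᴾ p
  ⊛-identityˡ p k = trans (const-⊛ (+ 1) p k) (ℤ.*-identityˡ (p k))

-- Integer constants embed homomorphically; this lets the ring solver use
-- integer coefficients, interpreted as the constant polynomials of Defs.
constHom : ℤ.+-*-rawRing -Raw-AlmostCommutative⟶ fromCommutativeRing PolyRing
constHom = record
  { ⟦_⟧ = const
  ; +-homo = λ a b → λ { zero → refl ; (suc k) → refl }
  ; *-homo = λ a b → λ { zero → refl
                       ; (suc k) → sym (trans (const-⊛ a (const b) (suc k)) (ℤ.*-zeroʳ a)) }
  ; -‿homo = λ a → λ { zero → refl ; (suc k) → refl }
  ; 0-homo = λ { zero → refl ; (suc k) → refl }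
  ; 1-homo = λ { zero → refl ; (suc k) → refl }
  }

const-equal? : ∀ a b → Maybe (const a ≈ᴾ const b)
const-equal? a b with a ℤ.≟ b
... | yes refl = just (λ _ → refl)
... | no _     = nothing

open import Algebra.Solver.Ring ℤ.+-*-rawRing (fromCommutativeRing PolyRing) constHom const-equal?
  using (solve; _:=_; _:+_; _:*_; _:-_; _:^_; con)

module PolyR = CommutativeRing PolyRing
module ≈-Reasoning = SetoidReasoning PolyR.setoid

X-⊛ : ∀ p k → (X ⊛ p) (suc k) ≡ p k
X-⊛ p k = begin
  (X ⊛ p) (suc k)             ≡⟨ ⊛-suc X p k ⟩
  (shiftᴾ X ⊛ p) k + + 0      ≡⟨ ℤ.+-identityʳ _ ⟩
  (shiftᴾ X ⊛ p) k            ≡⟨ ⊛-cong shiftX (λ _ → refl) k ⟩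
  (1ᴾ ⊛ p) k                  ≡⟨ PolyR.*-identityˡ p k ⟩
  p k                         ∎
  where
  open ≡-Reasoning
  shiftX : shiftᴾ X ≈ᴾ 1ᴾ
  shiftX zero    = refl
  shiftX (suc k) = refl

count : {A : Set} → (A → Bool) → List A → ℕ
count p xs = length (filterᵇ p xs)

count-cong : ∀ {A : Set} {p q : A → Bool} → (∀ x → p x ≡ q x) → ∀ xs → count p xs ≡ count q xs
count-cong e [] = refl
count-cong {p = p} {q} e (x ∷ xs) with p x | q x | e x
... | true  | true  | refl = cong suc (count-cong e xs)
... | false | false | refl = count-cong e xs

count-none : ∀ {A : Set} (xs : List A) → count (λ _ → false) xs ≡ 0
count-none []       = refl
count-none (x ∷ xs) = count-none xs

count-++ : ∀ {A : Set} (p : A → Bool) xs ys → count p (xs ++ ys) ≡ count p xs ℕ.+ count p ys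
count-++ p xs ys = trans (cong length (filter-++ (T? ∘ p) xs ys)) (length-++ (filterᵇ p xs))

count-map : ∀ {A B : Set} (p : B → Bool) (f : A → B) xs → count p (map f xs) ≡ count (p ∘ f) xs
count-map p f [] = refl
count-map p f (x ∷ xs) with p (f x)
... | true  = cong suc (count-map p f xs)
... | false = count-map p f xs

-- The enumerator of a property Q of bit strings of length N,
--   enum N Q = Σ { x^|D| : D ∈ {0,1}^N, Q D },
-- defined by recursion on the first bit.  Bit strings are lists so that
-- the length N can be rewritten independently of Q.
enum : ℕ → (List Bool → Bool) → Poly
enum zero    Q = if Q [] then 1ᴾ else 0ᴾ
enum (suc N) Q = enum N (λ L → Q (false ∷ L)) ⊕ (X ⊛ enum N (λ L → Q (true ∷ L)))

count-enum : ∀ N (Q : List Bool → Bool) k →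
  + count (λ D → Q (toList D) ∧ (size D ≡ᵇ k)) (allSubsets N) ≡ enum N Q k
count-enum zero Q k with Q []
count-enum zero Q zero    | true  = refl
count-enum zero Q (suc k) | true  = refl
count-enum zero Q zero    | false = refl
count-enum zero Q (suc k) | false = refl
count-enum (suc N) Q k = begin
  + count p (map (false ∷_) S ++ map (true ∷_) S)
    ≡⟨ cong +_ (count-++ p (map (false ∷_) S) (map (true ∷_) S)) ⟩
  + (count p (map (false ∷_) S) ℕ.+ count p (map (true ∷_) S))
    ≡⟨ ℤ.pos-+ (count p (map (false ∷_) S)) _ ⟩
  + count p (map (false ∷_) S) + + count p (map (true ∷_) S)
    ≡⟨ cong₂ _+_ (trans (cong +_ (count-map p (false ∷_) S)) (count-enum N (λ L → Q (false ∷ L)) k))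
                 (trans (cong +_ (count-map p (true ∷_) S)) (withTrue k)) ⟩
  enum N (λ L → Q (false ∷ L)) k + (X ⊛ enum N (λ L → Q (true ∷ L))) k ∎
  where
  open ≡-Reasoning
  S = allSubsets N
  p : Subset (suc N) → Bool
  p D = Q (toList D) ∧ (size D ≡ᵇ k)
  -- Subsets containing the first element have size one more.
  withTrue : ∀ k → + count (λ D → Q (true ∷ toList D) ∧ (suc (size D) ≡ᵇ k)) S
                   ≡ (X ⊛ enum N (λ L → Q (true ∷ L))) k
  withTrue zero    = cong +_ (trans (count-cong {q = λ _ → false} (λ D → ∧-zeroʳ (Q (true ∷ toList D))) S)
                                   (count-none S))
  withTrue (suc k) = trans (count-enum N (λ L → Q (true ∷ L)) k)
                           (sym (X-⊛ (enum N (λ L → Q (true ∷ L))) k))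

enum-false : ∀ N → enum N (λ _ → false) ≈ᴾ 0ᴾ
enum-false zero    = λ _ → refl
enum-false (suc N) = begin
  enum N (λ _ → false) ⊕ (X ⊛ enum N (λ _ → false))
    ≈⟨ ⊕-cong (enum-false N) (⊛-congˡ X (enum-false N)) ⟩
  0ᴾ ⊕ (X ⊛ 0ᴾ)
    ≈⟨ solve 1 (λ x → con (+ 0) :+ x :* con (+ 0) := con (+ 0)) (λ _ → refl) X ⟩
  0ᴾ ∎
  where open ≈-Reasoning

enum-split : ∀ k M (P R : List Bool → Bool) →
  enum (k ℕ.+ M) (λ L → P (take k L) ∧ R (drop k L)) ≈ᴾ enum k P ⊛ enum M R
enum-split zero M P R with P []
... | true  = PolyR.sym (PolyR.*-identityˡ (enum M R))
... | false = PolyR.trans (enum-false M) (PolyR.sym (PolyR.zeroˡ (enum M R)))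
enum-split (suc k) M P R = begin
  enum (k ℕ.+ M) (λ L → P (false ∷ take k L) ∧ R (drop k L))
    ⊕ (X ⊛ enum (k ℕ.+ M) (λ L → P (true ∷ take k L) ∧ R (drop k L)))
    ≈⟨ ⊕-cong (enum-split k M (λ L → P (false ∷ L)) R)
              (⊛-congˡ X (enum-split k M (λ L → P (true ∷ L)) R)) ⟩
  (enum k (λ L → P (false ∷ L)) ⊛ enum M R) ⊕ (X ⊛ (enum k (λ L → P (true ∷ L)) ⊛ enum M R))
    ≈⟨ solve 4 (λ x a b e → a :* e :+ x :* (b :* e) := (a :+ x :* b) :* e) (λ _ → refl)
             X (enum k (λ L → P (false ∷ L))) (enum k (λ L → P (true ∷ L))) (enum M R) ⟩
  enum (suc k) P ⊛ enum M R ∎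
  where open ≈-Reasoning

everyBlock : ℕ → ℕ → (List Bool → Bool) → List Bool → Bool
everyBlock k zero    B L = true
everyBlock k (suc m) B L = B (take k L) ∧ everyBlock k m B (drop k L)

enum-everyBlock : ∀ k m B → enum (m ℕ.* k) (everyBlock k m B) ≈ᴾ enum k B ^ᴾ m
enum-everyBlock k zero    B = λ _ → refl
enum-everyBlock k (suc m) B =
  PolyR.trans (enum-split k (m ℕ.* k) B (everyBlock k m B))
              (⊛-congˡ (enum k B) (enum-everyBlock k m B))

anyMarked : (ℕ → Bool) → List Bool → Bool
anyMarked g []      = false
anyMarked g (b ∷ L) = (g 0 ∧ b) ∨ anyMarked (g ∘ suc) L

allBelow : ℕ → (ℕ → Bool) → Bool
allBelow zero    h = true
allBelow (suc N) h = h 0 ∧ allBelow N (h ∘ suc)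

anyMarked-cong : ∀ {g g′} L → (∀ u → g u ≡ g′ u) → anyMarked g L ≡ anyMarked g′ L
anyMarked-cong []      e = refl
anyMarked-cong (b ∷ L) e = cong₂ (λ x y → (x ∧ b) ∨ y) (e 0) (anyMarked-cong L (e ∘ suc))

anyMarked-none : ∀ {g} L → (∀ u → g u ≡ false) → anyMarked g L ≡ false
anyMarked-none []      e = refl
anyMarked-none (b ∷ L) e = cong₂ (λ x y → (x ∧ b) ∨ y) (e 0) (anyMarked-none L (e ∘ suc))

allBelow-cong : ∀ N {h h′} → (∀ v → h v ≡ h′ v) → allBelow N h ≡ allBelow N h′
allBelow-cong zero    e = refl
allBelow-cong (suc N) e = cong₂ _∧_ (e 0) (allBelow-cong N (e ∘ suc))

isTDS-ℕ : ∀ N (a : ℕ → ℕ → Bool) (D : Subset N) →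
  isTDS (record { V = N ; adj = λ u v → a (toℕ u) (toℕ v) }) D
    ≡ allBelow N (λ v → anyMarked (a v) (toList D))
isTDS-ℕ N a D = begin
  and (map (λ v → or (map (test v) (allFin N))) (allFin N))
    ≡⟨ cong and (map-tabulate id (λ v → or (map (test v) (allFin N)))) ⟩
  and (tabulate (λ v → or (map (test v) (allFin N))))
    ≡⟨ cong and (tabulate-cong (λ v →
         trans (cong or (map-tabulate id (test v))) (or-marked D (a (toℕ v))))) ⟩
  and (tabulate {n = N} (λ v → anyMarked (a (toℕ v)) (toList D)))
    ≡⟨ and-below N (λ v → anyMarked (a v) (toList D)) ⟩
  allBelow N (λ v → anyMarked (a v) (toList D)) ∎
  where
  open ≡-Reasoning
  test : Fin N → Fin N → Bool
  test v u = a (toℕ v) (toℕ u) ∧ lookup D u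
  or-marked : ∀ {N} (D : Subset N) g →
    or (tabulate (λ u → g (toℕ u) ∧ lookup D u)) ≡ anyMarked g (toList D)
  or-marked []      g = refl
  or-marked (b ∷ D) g = cong ((g 0 ∧ b) ∨_) (or-marked D (g ∘ suc))
  and-below : ∀ N h → and (tabulate {n = N} (h ∘ toℕ)) ≡ allBelow N h
  and-below zero    h = refl
  and-below (suc N) h = cong (h 0 ∧_) (and-below N (h ∘ suc))

-- Translation symmetry of F_{n,4}: adding 3 to a non-hub vertex moves it to
-- the same position on the next cycle.

mod3-shift : ∀ u → (3 ℕ.+ u) % 3 ≡ u % 3
mod3-shift u = trans (cong (_% 3) (ℕ.+-comm 3 u)) ([m+n]%n≡m%n u 3)

adj-hub-shift : ∀ u → adjℕ (4 ℕ.+ u) 0 ≡ adjℕ (1 ℕ.+ u) 0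
adj-hub-shift u = cong (λ r → ((r ≡ᵇ 1) ∨ (r ≡ᵇ 0)) ∨ false) (mod3-shift (suc u))

adj-shift : ∀ u v → adjℕ (4 ℕ.+ u) (4 ℕ.+ v) ≡ adjℕ (1 ℕ.+ u) (1 ℕ.+ v)
adj-shift u v = cong₂ (λ e e′ → ((u <ᵇ v) ∧ e) ∨ ((v <ᵇ u) ∧ e′)) (edge-shift u v) (edge-shift v u)
  where
  edge-shift : ∀ u v → edgeℕ (4 ℕ.+ u) (4 ℕ.+ v) ≡ edgeℕ (1 ℕ.+ u) (1 ℕ.+ v)
  edge-shift u v = cong (λ r → (v ≡ᵇ suc u) ∧ not (r ≡ᵇ 0)) (mod3-shift (suc u))

dominated : ℕ → List Bool → Bool
dominated v = anyMarked (adjℕ v)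

-- The conditions on one cycle (a, b, d) when the hub has bit c: vertices a
-- and d are dominated iff c ∨ b, vertex b iff a ∨ d.
cycleOK : Bool → List Bool → Bool
cycleOK c (a ∷ b ∷ d ∷ _) = (c ∨ b) ∧ (a ∨ d)
cycleOK c _               = false

-- Vertices of the first cycle only see the hub and their own cycle.
dominated-1 : ∀ c a b d R → dominated 1 (c ∷ a ∷ b ∷ d ∷ R) ≡ c ∨ b
dominated-1 c a b d R =
  trans (cong (λ t → c ∨ (b ∨ t)) (anyMarked-none R (λ _ → refl))) (cong (c ∨_) (∨-identityʳ b))

dominated-2 : ∀ c a b d R → dominated 2 (c ∷ a ∷ b ∷ d ∷ R) ≡ a ∨ d
dominated-2 c a b d R =
  trans (cong (λ t → a ∨ (d ∨ t)) (anyMarked-none R (λ _ → refl))) (cong (a ∨_) (∨-identityʳ d))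

dominated-3 : ∀ c a b d R → dominated 3 (c ∷ a ∷ b ∷ d ∷ R) ≡ c ∨ b
dominated-3 c a b d R =
  trans (cong (λ t → c ∨ (b ∨ t)) (anyMarked-none R (λ u → cong (_∨ false) (∧-zeroʳ (u ≡ᵇ 0)))))
        (cong (c ∨_) (∨-identityʳ b))

dominated-shift : ∀ w c a b d R →
  dominated (4 ℕ.+ w) (c ∷ a ∷ b ∷ d ∷ R) ≡ dominated (1 ℕ.+ w) (c ∷ R)
dominated-shift w c a b d R = begin
  (adjℕ (4 ℕ.+ w) 0 ∧ c) ∨ ((((w ≡ᵇ 0) ∧ false) ∧ d) ∨ anyMarked (λ u → adjℕ (4 ℕ.+ w) (4 ℕ.+ u)) R)
    ≡⟨ cong (λ z → (adjℕ (4 ℕ.+ w) 0 ∧ c) ∨ ((z ∧ d) ∨ anyMarked (λ u → adjℕ (4 ℕ.+ w) (4 ℕ.+ u)) R))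
            (∧-zeroʳ (w ≡ᵇ 0)) ⟩
  (adjℕ (4 ℕ.+ w) 0 ∧ c) ∨ anyMarked (λ u → adjℕ (4 ℕ.+ w) (4 ℕ.+ u)) R
    ≡⟨ cong₂ (λ x t → (x ∧ c) ∨ t) (adj-hub-shift w) (anyMarked-cong R (adj-shift w)) ⟩
  (adjℕ (1 ℕ.+ w) 0 ∧ c) ∨ anyMarked (λ u → adjℕ (1 ℕ.+ w) (1 ℕ.+ u)) R ∎
  where open ≡-Reasoning

-- Once every cycle satisfies cycleOK, some a or d is in D, so the hub is
-- dominated as well.
hub-absorbed : ∀ c a b d R z →
  dominated 0 (c ∷ a ∷ b ∷ d ∷ R) ∧ (((c ∨ b) ∧ (a ∨ d)) ∧ z) ≡ ((c ∨ b) ∧ (a ∨ d)) ∧ z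
hub-absorbed c true  b d     R z = refl
hub-absorbed c false b true  R z = refl
hub-absorbed c false b false R z rewrite ∧-zeroʳ (c ∨ b) =
  ∧-zeroʳ (dominated 0 (c ∷ false ∷ b ∷ false ∷ R))

cycles-dominated : ∀ m c (R : Subset (m ℕ.* 3)) →
  allBelow (m ℕ.* 3) (λ v → dominated (suc v) (c ∷ toList R))
    ≡ everyBlock 3 m (cycleOK c) (toList R)
cycles-dominated zero    c []              = refl
cycles-dominated (suc m) c (a ∷ b ∷ d ∷ R) = begin
  dominated 1 L ∧ (dominated 2 L ∧ (dominated 3 L ∧ allBelow (m ℕ.* 3) (λ v → dominated (4 ℕ.+ v) L)))
    ≡⟨ cong₂ _∧_ (dominated-1 c a b d (toList R))
        (cong₂ _∧_ (dominated-2 c a b d (toList R))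
         (cong₂ _∧_ (dominated-3 c a b d (toList R)) later-cycles)) ⟩
  (c ∨ b) ∧ ((a ∨ d) ∧ ((c ∨ b) ∧ everyBlock 3 m (cycleOK c) (toList R)))
    ≡⟨ ∧-twice (c ∨ b) (a ∨ d) _ ⟩
  ((c ∨ b) ∧ (a ∨ d)) ∧ everyBlock 3 m (cycleOK c) (toList R) ∎
  where
  open ≡-Reasoning
  L = c ∷ a ∷ b ∷ d ∷ toList R
  later-cycles : allBelow (m ℕ.* 3) (λ v → dominated (4 ℕ.+ v) L) ≡ everyBlock 3 m (cycleOK c) (toList R)
  later-cycles = trans (allBelow-cong (m ℕ.* 3) (λ v → dominated-shift v c a b d (toList R)))
                       (cycles-dominated m c R)
  ∧-twice : ∀ x y z → x ∧ (y ∧ (x ∧ z)) ≡ (x ∧ y) ∧ z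
  ∧-twice true  y z = refl
  ∧-twice false y z = refl

-- Total dominating sets of F_{n,4} (n ≥ 1) in list form: hub bit c followed
-- by n cycles each satisfying cycleOK c.  The vertex count 3 · n is turned
-- into n · 3 so that the cycles can be peeled off one at a time.
tdsF4 : ℕ → List Bool → Bool
tdsF4 n []      = false
tdsF4 n (c ∷ L) = everyBlock 3 n (cycleOK c) L

isTDS-F4 : ∀ m (D : Subset (suc (3 ℕ.* suc m))) →
  isTDS (F4 (suc m)) D ≡ tdsF4 (suc m) (toList D)
isTDS-F4 m (c ∷ D) = begin
  isTDS (F4 n) (c ∷ D)
    ≡⟨ isTDS-ℕ (suc (3 ℕ.* n)) adjℕ (c ∷ D) ⟩
  allBelow (suc (3 ℕ.* n)) (λ v → dominated v (c ∷ toList D))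
    ≡⟨ cong₂ (λ N L → allBelow (suc N) (λ v → dominated v (c ∷ L)))
             (ℕ.*-comm 3 n) (sym (toList-cast (ℕ.*-comm 3 n) D)) ⟩
  allBelow (suc (n ℕ.* 3)) (λ v → dominated v (c ∷ toList D′))
    ≡⟨ all-cycles D′ ⟩
  everyBlock 3 n (cycleOK c) (toList D′)
    ≡⟨ cong (everyBlock 3 n (cycleOK c)) (toList-cast (ℕ.*-comm 3 n) D) ⟩
  everyBlock 3 n (cycleOK c) (toList D) ∎
  where
  open ≡-Reasoning
  n  = suc m
  D′ = cast (ℕ.*-comm 3 n) D
  all-cycles : (R : Subset (n ℕ.* 3)) →
    allBelow (suc (n ℕ.* 3)) (λ v → dominated v (c ∷ toList R))
      ≡ everyBlock 3 n (cycleOK c) (toList R)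
  all-cycles (a ∷ b ∷ d ∷ R) =
    trans (cong (dominated 0 (c ∷ a ∷ b ∷ d ∷ toList R) ∧_) (cycles-dominated n c (a ∷ b ∷ d ∷ R)))
          (hub-absorbed c a b d (toList R) _)

-- Generating polynomials of one cycle: with the hub in D, b is free and
-- {a, d} ≠ ∅, giving x(x+1)(x+2); with the hub outside D, b ∈ D and
-- {a, d} ≠ ∅, giving x³ + 2x².
cycleIn : Poly
cycleIn = X ⊛ ((X ⊕ const (+ 1)) ⊛ (X ⊕ const (+ 2)))

enum-cycle-in : enum 3 (cycleOK true) ≈ᴾ cycleIn
enum-cycle-in = solve 1 (λ x → let e = λ p q → p :+ x :* q in
    e (e (e (con (+ 0)) (con (+ 1))) (e (con (+ 0)) (con (+ 1))))
      (e (e (con (+ 1)) (con (+ 1))) (e (con (+ 1)) (con (+ 1))))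
  := x :* ((x :+ con (+ 1)) :* (x :+ con (+ 2)))) (λ _ → refl) X

enum-cycle-out : enum 3 (cycleOK false) ≈ᴾ P3poly
enum-cycle-out = solve 1 (λ x → let e = λ p q → p :+ x :* q in
    e (e (e (con (+ 0)) (con (+ 0))) (e (con (+ 0)) (con (+ 1))))
      (e (e (con (+ 0)) (con (+ 0))) (e (con (+ 1)) (con (+ 1))))
  := x :^ 3 :+ con (+ 2) :* x :^ 2) (λ _ → refl) X

^ᴾ-cong : ∀ {p q} n → p ≈ᴾ q → p ^ᴾ n ≈ᴾ q ^ᴾ n
^ᴾ-cong zero    e = λ _ → refl
^ᴾ-cong (suc n) e = ⊛-cong e (^ᴾ-cong n e)

enum-cycles : ∀ n c → enum (3 ℕ.* n) (everyBlock 3 n (cycleOK c)) ≈ᴾ enum 3 (cycleOK c) ^ᴾ n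
enum-cycles n c k =
  trans (cong (λ N → enum N (everyBlock 3 n (cycleOK c)) k) (ℕ.*-comm 3 n))
        (enum-everyBlock 3 n (cycleOK c) k)

-- Closed form: D_t(F_{n,4}) = (x³ + 2x²)ⁿ + x · (x(x+1)(x+2))ⁿ for n ≥ 1.
-- Both sides have constant term 0; the other coefficients are counted by
-- splitting on the hub bit.
Dt-F4 : ∀ m → Dt (F4 (suc m)) ≈ᴾ (P3poly ^ᴾ suc m) ⊕ (X ⊛ (cycleIn ^ᴾ suc m))
Dt-F4 m zero    = refl
Dt-F4 m (suc k) = begin
  Dt (F4 n) (suc k)
    ≡⟨ cong +_ (count-cong (λ D → cong (_∧ (size D ≡ᵇ suc k)) (isTDS-F4 m D)) (allSubsets vertices)) ⟩
  + count (λ D → tdsF4 n (toList D) ∧ (size D ≡ᵇ suc k)) (allSubsets vertices)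
    ≡⟨ count-enum vertices (tdsF4 n) (suc k) ⟩
  (enum (3 ℕ.* n) (everyBlock 3 n (cycleOK false))
     ⊕ (X ⊛ enum (3 ℕ.* n) (everyBlock 3 n (cycleOK true)))) (suc k)
    ≡⟨ ⊕-cong (λ j → trans (enum-cycles n false j) (^ᴾ-cong n enum-cycle-out j))
              (⊛-congˡ X (λ j → trans (enum-cycles n true j) (^ᴾ-cong n enum-cycle-in j))) (suc k) ⟩
  ((P3poly ^ᴾ n) ⊕ (X ⊛ (cycleIn ^ᴾ n))) (suc k) ∎
  where
  open ≡-Reasoning
  n = suc m
  vertices = suc (3 ℕ.* n)

-- Substituting the closed form for n and n - 1, the recurrence and the
-- initial value become polynomial identities in x, (x(x+1)(x+2))ⁿ⁻¹ and
-- (x³ + 2x²)ⁿ⁻¹.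
mainTheorem3 : ((n : ℕ) → 2 ≤ n → (k : ℕ) →
    Dt (F4 n) k
    ≡ ((X ⊛ (X ⊕ const (+ 2)))
    ⊛ (((X ⊕ const (+ 1)) ⊛ Dt (F4 (n ∸ 1))) ⊖ (P3poly ^ᴾ (n ∸ 1)))) k)
    × ((k : ℕ) → Dt (F4 1) k ≡ F1poly k)
mainTheorem3 = recurrence , initial
  where
  open ≈-Reasoning
  recurrence : (n : ℕ) → 2 ≤ n → Dt (F4 n) ≈ᴾ
    (X ⊛ (X ⊕ const (+ 2))) ⊛ (((X ⊕ const (+ 1)) ⊛ Dt (F4 (n ∸ 1))) ⊖ (P3poly ^ᴾ (n ∸ 1)))
  recurrence (suc zero)    (s≤s ())
  recurrence (suc (suc m)) _ = begin
    Dt (F4 (2 ℕ.+ m))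
      ≈⟨ Dt-F4 (suc m) ⟩
    (P3poly ⊛ cyclesOut) ⊕ (X ⊛ (cycleIn ⊛ cyclesIn))
      ≈⟨ solve 3 (λ x u v →
             (x :^ 3 :+ con (+ 2) :* x :^ 2) :* v :+ x :* ((x :* ((x :+ con (+ 1)) :* (x :+ con (+ 2)))) :* u)
          := (x :* (x :+ con (+ 2))) :* ((x :+ con (+ 1)) :* (v :+ x :* u) :- v))
           (λ _ → refl) X cyclesIn cyclesOut ⟩
    (X ⊛ (X ⊕ const (+ 2))) ⊛ (((X ⊕ const (+ 1)) ⊛ (cyclesOut ⊕ (X ⊛ cyclesIn))) ⊖ cyclesOut)
      ≈⟨ ⊛-congˡ (X ⊛ (X ⊕ const (+ 2)))
                 (⊕-cong (⊛-congˡ (X ⊕ const (+ 1)) (PolyR.sym (Dt-F4 m))) PolyR.refl) ⟩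
    (X ⊛ (X ⊕ const (+ 2))) ⊛ (((X ⊕ const (+ 1)) ⊛ Dt (F4 (suc m))) ⊖ cyclesOut) ∎
    where
    cyclesIn cyclesOut : Poly
    cyclesIn  = cycleIn ^ᴾ suc m
    cyclesOut = P3poly ^ᴾ suc m
  initial : Dt (F4 1) ≈ᴾ F1poly
  initial = begin
    Dt (F4 1)
      ≈⟨ Dt-F4 0 ⟩
    (P3poly ^ᴾ 1) ⊕ (X ⊛ (cycleIn ^ᴾ 1))
      ≈⟨ solve 1 (λ x → (x :^ 3 :+ con (+ 2) :* x :^ 2) :* con (+ 1)
                        :+ x :* ((x :* ((x :+ con (+ 1)) :* (x :+ con (+ 2)))) :* con (+ 1))
                     := x :^ 4 :+ (con (+ 4) :* x :^ 3 :+ con (+ 4) :* x :^ 2)) (λ _ → refl) X ⟩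
    F1poly ∎
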